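{- Let $Q = v_1, e_1, \ldots, e_{s-1}, v_s$ be a path in a graph and let $q \geq 2$ be an integer. Let $A$ and $B$ be nonempty subsets of $V(Q)$ such that for each $v_i \in A$ and $v_j \in B$, either $i = j$ or $|i-j| \geq q$. Then: (i) if $A = B$, then $s \geq 1 + q(|A| - 1)$, with equality only if $A = \{v_1, v_{1+q}, v_{1+2q}, \ldots, v_s\}$; (ii) if $B \neq A$, then $s \geq |A| + |B| + q - 2$, with equality only if $A \subset B$ or $B \subset A$. -}

module Defs where

open import Data.Nat using (ℕ; _≤_; ∣_-_∣)
open import Data.Fin using (Fin; toℕ)
open import Data.Fin.Subset using (Subset; _∈_)
open import Data.Sum using (_⊎_)
open import Relation.Binary.PropositionalEquality using (_≡_)

-- A path Q = v_1, e_1, ..., e_{s-1}, v_s has s distinct vertices, so a subset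
-- of V(Q) is the same as a subset of the index set; we index vertices by
-- Fin s (0-based: index i stands for v_{i+1}).
Separated : {s : ℕ} → ℕ → Subset s → Subset s → Set
Separated {s} q A B =
  (i j : Fin s) → i ∈ A → j ∈ B → (i ≡ j) ⊎ (q ≤ ∣ toℕ i - toℕ j ∣)

{-# OPTIONS --safe #-}
module Submission where

-- Induct along the path, deleting its first vertex v₁. The induction has to remember how many
-- of the following vertices are forced out of the sets, so every statement is made for sets
-- whose indices are all at least an offset k, and charges k extra vertices. A point of A at v₁
-- forces the next q − 1 vertices out of B and vice versa. For (i) each point of A therefore
-- costs q vertices, and equality forces all gaps to be exactly q. For (ii), if v₁ lies in A only,
-- either the rest of A equals B, and (i) gives more room than needed, or the rests still differ
-- and induction applies; if v₁ lies in both sets, both rests start after offset q − 1, which pays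
-- for the two deleted points.

open import Defs
open import Data.Bool using (Bool; true; false)
import Data.Bool as Bool
open import Data.Empty using (⊥-elim)
open import Data.Fin using (Fin; zero; suc; toℕ)
open import Data.Fin.Properties as Fin using (¬Fin0)
open import Data.Fin.Subset using (Subset; _∈_; _⊆_; _⊂_; ∣_∣; Nonempty; Empty)
open import Data.Fin.Subset.Properties
  using ( Empty-unique; ∣⊥∣≡0; ∣p∣≤n; nonempty?; drop-there; x∈p⇒∣p-x∣<∣p∣
        ; ⊆-refl; p⊂q⇒p⊆q; out⊂; out⊂in; in⊂in)
open import Data.Nat using (ℕ; zero; suc; _≤_; _≰_; _<_; _+_; _*_; _∸_; z≤n; s≤s; s≤s⁻¹)
open import Data.Nat.Divisibility using (_∣_; _∣0; ∣-refl; ∣⇒≤; ∣m+n∣m⇒∣n; ∣m∸n∣n⇒∣m)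
open import Data.Nat.Properties
open import Data.Nat.Tactic.RingSolver using (solve-∀)
open import Data.Product using (_×_; _,_; proj₂; map₁)
open import Data.Sum as Sum using (_⊎_; inj₁; inj₂)
open import Data.Vec using (_∷_; []; here; there)
open import Data.Vec.Properties using (≡-dec)
open import Function using (_∘_)
open import Function.Bundles using (_⇔_; mk⇔)
open import Function.Properties.Equivalence using () renaming (trans to ⇔-trans; sym to ⇔-sym)
open import Relation.Nullary using (¬_; yes; no)
open import Relation.Binary.PropositionalEquality using (_≡_; _≢_; refl; sym; trans; cong; subst; subst₂)

private variable
  n k p q x : ℕ
  b c : Bool
  A B : Subset n
  i : Fin n

1+m+n≰n : ∀ m n → suc m + n ≰ n
1+m+n≰n m n 1+m+n≤n = 1+n≰n (≤-trans (s≤s (m≤n+m n m)) 1+m+n≤n)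

p+[1+[1+p]*[m∸1]]≡[1+p]*m : ∀ p {m} → 0 < m → p + suc (suc p * (m ∸ 1)) ≡ suc p * m
p+[1+[1+p]*[m∸1]]≡[1+p]*m p {suc m} _ = trans (+-suc p _) (sym (*-suc (suc p) m))

m+m+r≤1+r+1+[2+r]*[m∸1] : ∀ r {m} → 0 < m → m + m + r ≤ suc r + suc (suc (suc r) * (m ∸ 1))
m+m+r≤1+r+1+[2+r]*[m∸1] r {suc m} _ = ≤-trans (m≤m+n _ (r * m)) (≤-reflexive (sym (expand r m)))
  where
  expand : ∀ r m → suc r + suc (suc (suc r) * m) ≡ suc m + suc m + r + r * m
  expand = solve-∀

k+[a+b+r]≡k+[b+a+r] : ∀ k a b r → k + (a + b + r) ≡ k + (b + a + r)
k+[a+b+r]≡k+[b+a+r] k a b r = cong (λ m → k + (m + r)) (+-comm a b)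

suc∈∷⇔∈ : suc i ∈ (b ∷ A) ⇔ i ∈ A
suc∈∷⇔∈ = mk⇔ drop-there there

nonempty-tail : Nonempty (false ∷ A) → Nonempty A
nonempty-tail (zero , ())
nonempty-tail (suc i , there i∈A) = i , i∈A

Empty⇒∣p∣≡0 : {A : Subset n} → Empty A → ∣ A ∣ ≡ 0
Empty⇒∣p∣≡0 {n = n} ¬neA = trans (cong ∣_∣ (Empty-unique ¬neA)) (∣⊥∣≡0 n)

Nonempty⇒0<∣p∣ : Nonempty A → 0 < ∣ A ∣
Nonempty⇒0<∣p∣ (_ , i∈A) = ≤-trans (s≤s z≤n) (x∈p⇒∣p-x∣<∣p∣ i∈A)

Empty⇒⊂Nonempty : Empty A → Nonempty B → A ⊂ B
Empty⇒⊂Nonempty ¬neA (i , i∈B) =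
  (λ j∈A → ⊥-elim (¬neA (_ , j∈A))) , i , i∈B , λ i∈A → ¬neA (i , i∈A)

LowerBound : ℕ → Subset n → Set
LowerBound k A = ∀ i → i ∈ A → k ≤ toℕ i

lowerBound-zero : LowerBound 0 A
lowerBound-zero _ _ = z≤n

lowerBound-tail : LowerBound (suc k) (b ∷ A) → LowerBound k A
lowerBound-tail lb i i∈A = s≤s⁻¹ (lb (suc i) (there i∈A))

lowerBound-head : ¬ LowerBound (suc k) (true ∷ A)
lowerBound-head lb with () ← lb zero here

lowerBound-⊆ : A ⊆ B → LowerBound k B → LowerBound k A
lowerBound-⊆ A⊆B lb i = lb i ∘ A⊆B

lowerBound⇒k+∣p∣≤n : ∀ k (A : Subset n) → Nonempty A → LowerBound k A → k + ∣ A ∣ ≤ n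
lowerBound⇒k+∣p∣≤n zero    A           _   _  = ∣p∣≤n A
lowerBound⇒k+∣p∣≤n (suc k) (true ∷ A)  _   lb = ⊥-elim (lowerBound-head lb)
lowerBound⇒k+∣p∣≤n (suc k) (false ∷ A) neA lb =
  s≤s (lowerBound⇒k+∣p∣≤n k A (nonempty-tail neA) (lowerBound-tail lb))

separated-tail : Separated q (b ∷ A) (c ∷ B) → Separated q A B
separated-tail sep i j i∈A j∈B = Sum.map₁ Fin.suc-injective (sep (suc i) (suc j) (there i∈A) (there j∈B))

separated-sym : Separated q A B → Separated q B A
separated-sym {q = q} sep i j i∈B j∈A =
  Sum.map sym (subst (q ≤_) (∣-∣-comm (toℕ j) (toℕ i))) (sep j i j∈A i∈B)

separated-lowerBoundʳ : Separated (suc p) (true ∷ A) (c ∷ B) → LowerBound p B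
separated-lowerBoundʳ sep j j∈B with sep zero (suc j) here (there j∈B)
... | inj₂ q≤1+j = s≤s⁻¹ q≤1+j

separated-lowerBoundˡ : Separated (suc p) (b ∷ A) (true ∷ B) → LowerBound p A
separated-lowerBoundˡ = separated-lowerBoundʳ ∘ separated-sym

InProgression : ℕ → ℕ → ℕ → Set
InProgression q k x = k ≤ x × q ∣ x ∸ k

inProgression-zero : InProgression q 0 x ⇔ q ∣ x
inProgression-zero = mk⇔ proj₂ (z≤n ,_)

inProgression-suc : InProgression q k x ⇔ InProgression q (suc k) (suc x)
inProgression-suc = mk⇔ (map₁ s≤s) (map₁ s≤s⁻¹)

inProgression-∣suc : InProgression (suc p) p x ⇔ suc p ∣ suc x
inProgression-∣suc {p} {x} = mk⇔ to from
  where
  to : InProgression (suc p) p x → suc p ∣ suc x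
  to (p≤x , q∣x∸p) = ∣m∸n∣n⇒∣m (suc p) (s≤s p≤x) q∣x∸p ∣-refl
  from : suc p ∣ suc x → InProgression (suc p) p x
  from q∣1+x = p≤x , ∣m+n∣m⇒∣n (subst (suc p ∣_) (sym (m+[n∸m]≡n (s≤s p≤x))) q∣1+x) ∣-refl
    where
    p≤x : p ≤ x
    p≤x = s≤s⁻¹ (∣⇒≤ q∣1+x)

sparse-bound : ∀ p k (A : Subset n) → Separated (suc p) A A → Nonempty A → LowerBound k A
             → k + suc (suc p * (∣ A ∣ ∸ 1)) ≤ n
sparse-bound p k       []          _   (() , _) _
sparse-bound p (suc k) (true ∷ A)  _   _   lb = ⊥-elim (lowerBound-head lb)
sparse-bound p (suc k) (false ∷ A) sep neA lb =
  s≤s (sparse-bound p k A (separated-tail sep) (nonempty-tail neA) (lowerBound-tail lb))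
sparse-bound p zero    (false ∷ A) sep neA _  =
  m≤n⇒m≤1+n (sparse-bound p zero A (separated-tail sep) (nonempty-tail neA) lowerBound-zero)
sparse-bound {suc n} p zero (true ∷ A) sep _ _ with nonempty? A
... | no ¬neA rewrite Empty⇒∣p∣≡0 ¬neA | *-zeroʳ p = s≤s z≤n
... | yes neA = s≤s (subst (_≤ n) (p+[1+[1+p]*[m∸1]]≡[1+p]*m p (Nonempty⇒0<∣p∣ neA))
                      (sparse-bound p p A (separated-tail sep) neA (separated-lowerBoundʳ sep)))

sparse-tight : ∀ p k (A : Subset n) → Separated (suc p) A A → Nonempty A → LowerBound k A
             → n ≡ k + suc (suc p * (∣ A ∣ ∸ 1))
             → ∀ i → i ∈ A ⇔ InProgression (suc p) k (toℕ i)
sparse-tight p k       []          _   (() , _) _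
sparse-tight p (suc k) (true ∷ A)  _   _   lb _ = ⊥-elim (lowerBound-head lb)
sparse-tight p (suc k) (false ∷ A) _   _   _  _  zero = mk⇔ (λ ()) (λ ())
sparse-tight p (suc k) (false ∷ A) sep neA lb eq (suc i) =
  ⇔-trans suc∈∷⇔∈ (⇔-trans
    (sparse-tight p k A (separated-tail sep) (nonempty-tail neA) (lowerBound-tail lb) (suc-injective eq) i)
    inProgression-suc)
sparse-tight p zero    (false ∷ A) sep neA _  eq = ⊥-elim (<-irrefl (sym (suc-injective eq))
  (sparse-bound p zero A (separated-tail sep) (nonempty-tail neA) lowerBound-zero))
sparse-tight p zero    (true ∷ A)  _   _   _  _  zero = mk⇔ (λ _ → z≤n , (suc p ∣0)) (λ _ → here)
sparse-tight {suc n} p zero (true ∷ A) sep _ _ eq (suc i) with nonempty? A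
... | no ¬neA = ⊥-elim (¬Fin0 (subst Fin n≡0 i))
  where
  n≡0 : n ≡ 0
  n≡0 = trans (suc-injective eq) (trans (cong (suc p *_) (Empty⇒∣p∣≡0 ¬neA)) (*-zeroʳ (suc p)))
... | yes neA =
  ⇔-trans suc∈∷⇔∈ (⇔-trans
    (sparse-tight p p A (separated-tail sep) neA (separated-lowerBoundʳ sep) n≡ i)
    (⇔-trans inProgression-∣suc (⇔-sym inProgression-zero)))
  where
  n≡ : n ≡ p + suc (suc p * (∣ A ∣ ∸ 1))
  n≡ = trans (suc-injective eq) (sym (p+[1+[1+p]*[m∸1]]≡[1+p]*m p (Nonempty⇒0<∣p∣ neA)))

-- With q = 2 + r, ∣ A ∣ + ∣ B ∣ + r is the paper's |A| + |B| + q − 2, free of truncated subtraction.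
separated-bound : ∀ r k (A B : Subset n) → Separated (2 + r) A B → Nonempty A → Nonempty B → A ≢ B
                → LowerBound k A → LowerBound k B → k + (∣ A ∣ + ∣ B ∣ + r) ≤ n
separated-bound-in-out : ∀ r (A B : Subset n) → Separated (2 + r) (true ∷ A) (false ∷ B) → Nonempty B
                       → ∣ true ∷ A ∣ + ∣ false ∷ B ∣ + r ≤ suc n
separated-bound-in-in : ∀ r (A B : Subset n) → Separated (2 + r) (true ∷ A) (true ∷ B) → A ≢ B
                      → ∣ true ∷ A ∣ + ∣ true ∷ B ∣ + r ≤ suc n

separated-bound r k       []          []          _   (() , _) _ _ _ _
separated-bound r (suc k) (true ∷ A)  _           _   _ _ _ lbA _   = ⊥-elim (lowerBound-head lbA)
separated-bound r (suc k) (false ∷ A) (true ∷ B)  _   _ _ _ _   lbB = ⊥-elim (lowerBound-head lbB)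
separated-bound r (suc k) (false ∷ A) (false ∷ B) sep neA neB A≢B lbA lbB =
  s≤s (separated-bound r k A B (separated-tail sep) (nonempty-tail neA) (nonempty-tail neB)
        (A≢B ∘ cong (false ∷_)) (lowerBound-tail lbA) (lowerBound-tail lbB))
separated-bound r zero    (false ∷ A) (false ∷ B) sep neA neB A≢B _ _ =
  m≤n⇒m≤1+n (separated-bound r zero A B (separated-tail sep) (nonempty-tail neA) (nonempty-tail neB)
              (A≢B ∘ cong (false ∷_)) lowerBound-zero lowerBound-zero)
separated-bound r zero    (true ∷ A)  (false ∷ B) sep _   neB _   _ _ =
  separated-bound-in-out r A B sep (nonempty-tail neB)
separated-bound {suc n} r zero (false ∷ A) (true ∷ B) sep neA _ _ _ _ =
  subst (_≤ suc n) (k+[a+b+r]≡k+[b+a+r] 0 ∣ true ∷ B ∣ ∣ false ∷ A ∣ r)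
    (separated-bound-in-out r B A (separated-sym sep) (nonempty-tail neA))
separated-bound r zero    (true ∷ A)  (true ∷ B)  sep _   _   A≢B _ _ =
  separated-bound-in-in r A B sep (A≢B ∘ cong (true ∷_))

separated-bound-in-out {n} r A B sep neB with nonempty? A | ≡-dec Bool._≟_ A B
... | no ¬neA | _ rewrite Empty⇒∣p∣≡0 ¬neA =
  s≤s (subst (_≤ n) (+-comm r ∣ B ∣)
         (<⇒≤ (lowerBound⇒k+∣p∣≤n (suc r) B neB (separated-lowerBoundʳ sep))))
... | yes neA | yes refl =
  s≤s (≤-trans (m+m+r≤1+r+1+[2+r]*[m∸1] r (Nonempty⇒0<∣p∣ neA))
               (sparse-bound (suc r) (suc r) A (separated-tail sep) neA (separated-lowerBoundʳ sep)))
... | yes neA | no A≢B =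
  s≤s (separated-bound r zero A B (separated-tail sep) neA neB A≢B lowerBound-zero lowerBound-zero)

separated-bound-in-in {n} r A B sep A≢B =
  s≤s (subst (_≤ n) (cong (_+ r) (sym (+-suc ∣ A ∣ ∣ B ∣))) bound)
  where
  bound : suc (∣ A ∣ + ∣ B ∣ + r) ≤ n
  bound with nonempty? A | nonempty? B
  ... | no ¬neA | no ¬neB = ⊥-elim (A≢B (trans (Empty-unique ¬neA) (sym (Empty-unique ¬neB))))
  ... | no ¬neA | yes neB rewrite Empty⇒∣p∣≡0 ¬neA =
    subst (_≤ n) (cong suc (+-comm r ∣ B ∣))
      (lowerBound⇒k+∣p∣≤n (suc r) B neB (separated-lowerBoundʳ sep))
  ... | yes neA | no ¬neB rewrite Empty⇒∣p∣≡0 ¬neB =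
    subst (_≤ n) (cong suc (trans (+-comm r ∣ A ∣) (cong (_+ r) (sym (+-identityʳ ∣ A ∣)))))
      (lowerBound⇒k+∣p∣≤n (suc r) A neA (separated-lowerBoundˡ sep))
  ... | yes neA | yes neB =
    ≤-trans (s≤s (m≤n+m _ r)) (separated-bound r (suc r) A B (separated-tail sep) neA neB A≢B
                                 (separated-lowerBoundˡ sep) (separated-lowerBoundʳ sep))

separated-tight : ∀ r k (A B : Subset n) → Separated (2 + r) A B → Nonempty A → Nonempty B → A ≢ B
                → LowerBound k A → LowerBound k B → n ≡ k + (∣ A ∣ + ∣ B ∣ + r) → A ⊂ B ⊎ B ⊂ A
separated-tight-in-out : ∀ r (A B : Subset n) → Separated (2 + r) (true ∷ A) (false ∷ B) → Nonempty B
                       → suc n ≡ ∣ true ∷ A ∣ + ∣ false ∷ B ∣ + r → (false ∷ B) ⊂ (true ∷ A)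
separated-tight-in-in : ∀ r (A B : Subset n) → Separated (2 + r) (true ∷ A) (true ∷ B) → A ≢ B
                      → suc n ≡ ∣ true ∷ A ∣ + ∣ true ∷ B ∣ + r → A ⊂ B ⊎ B ⊂ A

separated-tight r k       []          []          _   (() , _) _ _ _ _ _
separated-tight r (suc k) (true ∷ A)  _           _   _ _ _ lbA _   _ = ⊥-elim (lowerBound-head lbA)
separated-tight r (suc k) (false ∷ A) (true ∷ B)  _   _ _ _ _   lbB _ = ⊥-elim (lowerBound-head lbB)
separated-tight r (suc k) (false ∷ A) (false ∷ B) sep neA neB A≢B lbA lbB eq =
  Sum.map out⊂ out⊂
    (separated-tight r k A B (separated-tail sep) (nonempty-tail neA) (nonempty-tail neB)
      (A≢B ∘ cong (false ∷_)) (lowerBound-tail lbA) (lowerBound-tail lbB) (suc-injective eq))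
separated-tight {suc n} r zero (false ∷ A) (false ∷ B) sep neA neB A≢B _ _ eq =
  ⊥-elim (1+n≰n (subst (_≤ n) (sym eq)
    (separated-bound r zero A B (separated-tail sep) (nonempty-tail neA) (nonempty-tail neB)
      (A≢B ∘ cong (false ∷_)) lowerBound-zero lowerBound-zero)))
separated-tight r zero    (true ∷ A)  (false ∷ B) sep _   neB _   _ _ eq =
  inj₂ (separated-tight-in-out r A B sep (nonempty-tail neB) eq)
separated-tight r zero    (false ∷ A) (true ∷ B)  sep neA _   _   _ _ eq =
  inj₁ (separated-tight-in-out r B A (separated-sym sep) (nonempty-tail neA)
         (trans eq (k+[a+b+r]≡k+[b+a+r] 0 ∣ false ∷ A ∣ ∣ true ∷ B ∣ r)))
separated-tight r zero    (true ∷ A)  (true ∷ B)  sep _   _   A≢B _ _ eq =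
  Sum.map in⊂in in⊂in (separated-tight-in-in r A B sep (A≢B ∘ cong (true ∷_)) eq)

separated-tight-in-out {n} r A B sep neB eq with nonempty? A | ≡-dec Bool._≟_ A B
... | no ¬neA | _ = ⊥-elim (1+n≰n (subst₂ _≤_ (cong suc (+-comm r ∣ B ∣)) n≡∣B∣+r B-bound))
  where
  B-bound : suc r + ∣ B ∣ ≤ n
  B-bound = lowerBound⇒k+∣p∣≤n (suc r) B neB (separated-lowerBoundʳ sep)
  n≡∣B∣+r : n ≡ ∣ B ∣ + r
  n≡∣B∣+r = trans (suc-injective eq) (cong (λ a → a + ∣ B ∣ + r) (Empty⇒∣p∣≡0 ¬neA))
... | yes _ | yes refl = out⊂in ⊆-refl
... | yes neA | no A≢B with separated-tight r zero A B (separated-tail sep) neA neB A≢B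
                              lowerBound-zero lowerBound-zero (suc-injective eq)
...   | inj₂ B⊂A = out⊂ B⊂A
...   | inj₁ A⊂B =
  ⊥-elim (1+m+n≰n r _ (subst (suc r + (∣ A ∣ + ∣ B ∣ + r) ≤_) (suc-injective eq) shifted))
  where
  -- A ⊂ B puts A at offset q − 1 as well, and the resulting bound contradicts tightness.
  shifted : suc r + (∣ A ∣ + ∣ B ∣ + r) ≤ n
  shifted = separated-bound r (suc r) A B (separated-tail sep) neA neB A≢B
              (lowerBound-⊆ (p⊂q⇒p⊆q A⊂B) (separated-lowerBoundʳ sep)) (separated-lowerBoundʳ sep)

separated-tight-in-in {n} r A B sep A≢B eq with nonempty? A | nonempty? B
... | no ¬neA | no ¬neB = ⊥-elim (A≢B (trans (Empty-unique ¬neA) (sym (Empty-unique ¬neB))))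
... | no ¬neA | yes neB = inj₁ (Empty⇒⊂Nonempty ¬neA neB)
... | yes neA | no ¬neB = inj₂ (Empty⇒⊂Nonempty ¬neB neA)
... | yes neA | yes neB =
  -- the bound at offset q − 1 and tightness force q = 2, so that bound is tight as well
  separated-tight r (suc r) A B (separated-tail sep) neA neB A≢B lbA lbB
    (≤-antisym (≤-trans (≤-reflexive n≡1+X) (s≤s (m≤n+m _ r)))
               (separated-bound r (suc r) A B (separated-tail sep) neA neB A≢B lbA lbB))
  where
  lbA : LowerBound (suc r) A
  lbA = separated-lowerBoundˡ sep
  lbB : LowerBound (suc r) B
  lbB = separated-lowerBoundʳ sep
  n≡1+X : n ≡ suc (∣ A ∣ + ∣ B ∣ + r)
  n≡1+X = trans (suc-injective eq) (cong (_+ r) (+-suc ∣ A ∣ ∣ B ∣))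

lemma3 : (s q : ℕ) → 2 ≤ q → (A B : Subset s) → Nonempty A → Nonempty B → Separated q A B
           → ((A ≡ B) → (1 + q * (∣ A ∣ ∸ 1) ≤ s)
                        × (s ≡ 1 + q * (∣ A ∣ ∸ 1) → (i : Fin s) → (i ∈ A ⇔ q ∣ toℕ i)))
             × (¬ (B ≡ A) → (∣ A ∣ + ∣ B ∣ + q ∸ 2 ≤ s)
                           × (s ≡ ∣ A ∣ + ∣ B ∣ + q ∸ 2 → (A ⊂ B) ⊎ (B ⊂ A)))
lemma3 s (suc (suc r)) (s≤s (s≤s _)) A B neA neB sep =
  (λ { refl → sparse-bound (suc r) 0 A sep neA lowerBound-zero
            , λ s≡ i → ⇔-trans (sparse-tight (suc r) 0 A sep neA lowerBound-zero s≡ i)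
                               inProgression-zero })
  , λ B≢A → subst (_≤ s) (sym size≡)
                (separated-bound r 0 A B sep neA neB (B≢A ∘ sym) lowerBound-zero lowerBound-zero)
          , λ s≡ → separated-tight r 0 A B sep neA neB (B≢A ∘ sym) lowerBound-zero lowerBound-zero
                     (trans s≡ size≡)
  where
  size≡ : ∣ A ∣ + ∣ B ∣ + suc (suc r) ∸ 2 ≡ ∣ A ∣ + ∣ B ∣ + r
  size≡ = cong (_∸ 2) (trans (+-suc _ (suc r)) (cong suc (+-suc _ r)))
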